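{- Let $m$ be an odd positive integer. If $K^*_{2m}$ admits a $\vec{C}_m$-factorization, then $K^*_{2(3m)}$ admits a $\vec{C}_{3m}$-factorization.
   Context: $K^*_n$ denotes the complete symmetric digraph on $n$ vertices (all ordered pairs of distinct vertices are arcs). $\vec{C}_\ell$ is the directed cycle of length $\ell$. A $\vec{C}_\ell$-factor of a digraph is a spanning subdigraph that is a disjoint union of directed $\ell$-cycles; a $\vec{C}_\ell$-factorization is a partition of the arc set into the arc sets of $\vec{C}_\ell$-factors. -}

module Defs where

open import Data.Nat using (ℕ; suc; _*_; _≤_; NonZero)
open import Data.Fin using (Fin; toℕ)
open import Data.Nat.DivMod using (_mod_)
open import Data.Product using (Σ; ∃; ∃-syntax; _×_; _,_)
open import Relation.Binary.PropositionalEquality using (_≡_; _≢_)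

next : {ℓ : ℕ} → Fin ℓ → Fin ℓ
next {suc ℓ} i = suc (toℕ i) mod (suc ℓ)

-- A directed ℓ-cycle on vertex set Fin n is given by its cyclic vertex
-- sequence c 0, …, c (ℓ-1); its arcs are (c i , c (next i)).
-- A family of k directed ℓ-cycles is  F : Fin k → Fin ℓ → Fin n.
-- It is a C_ℓ-factor of K*_n iff the cycles are pairwise vertex-disjoint,
-- each cycle has distinct vertices, and every vertex is covered; i.e.
-- (j , i) ↦ F j i is a bijection Fin k × Fin ℓ → Fin n.
record CycleFactor (n ℓ : ℕ) : Set where
  field
    k         : ℕ
    cyc       : Fin k → Fin ℓ → Fin n
    injective : ∀ j i j′ i′ → cyc j i ≡ cyc j′ i′ → (j ≡ j′ × i ≡ i′)
    surjective : ∀ v → ∃[ j ] ∃[ i ] cyc j i ≡ v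
open CycleFactor public

HasArc : {n ℓ : ℕ} → CycleFactor n ℓ → Fin n → Fin n → Set
HasArc F u v = ∃[ j ] ∃[ i ] (cyc F j i ≡ u × cyc F j (next i) ≡ v)

-- A C_ℓ-factorization of K*_n: a family of t C_ℓ-factors (indexed by Fin t)
-- whose arc sets partition the arc set of K*_n: every arc (u , v), u ≢ v,
-- lies in exactly one factor, and every arc of every factor is an arc of
-- K*_n (no loops; this only matters for ℓ = 1).
record CycleFactorization (n ℓ : ℕ) : Set where
  field
    t        : ℕ
    factor   : Fin t → CycleFactor n ℓ
    noLoops  : ∀ s u v → HasArc (factor s) u v → u ≢ v
    covers   : ∀ u v → u ≢ v → ∃[ s ] HasArc (factor s) u v
    disjoint : ∀ u v s s′ → HasArc (factor s) u v → HasArc (factor s′) u v → s ≡ s′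

HasCFactorization : (n ℓ : ℕ) → Set
HasCFactorization n ℓ = CycleFactorization n ℓ

-- Take V × Fin 3 as the vertex set of K*_{6m}, where V is that of K*_{2m}. A directed
-- Hamiltonian cycle τ of the lexicographic product C_m[K̄₃] (cells (i , x), arcs
-- (i , x) → (i + 1 , y)) lifts every C_m-factor of K*_{2m} to a C_{3m}-factor of K*_{6m}:
-- follow τ and read the position i on an m-cycle c as the vertex (c i , x). C_m[K̄₃] splits
-- into 3 Hamiltonian cycles and, for odd m ≥ 3, C_m[K*₃] (which also has the arcs
-- (i , x) → (i , y), x ≠ y) splits into 5. Lifting one factor along the second decomposition
-- and the other 2m − 2 along the first gives 3(2m − 2) + 5 = 6m − 1 factors using every arc
-- of K*_{6m} exactly once.
--
-- Each of these Hamiltonian cycles visits the cells in one of four fixed orders and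
-- relabels the levels at a position according to its class (A and B alternating, C at the
-- last position, which needs m odd). The steps at a position then depend only on the classes
-- at its two ends, so the decomposition properties reduce to finite tables, checked by
-- decision procedures. For m = 1 there is nothing to prove: K*₂ has no C₁-factorization.

module Submission where

open import Data.Bool as Bool using (Bool; true; false; if_then_else_)
open import Data.Empty using (⊥-elim)
open import Data.Fin as Fin using (Fin; zero; suc; toℕ; fromℕ; inject₁; _↑ˡ_; _↑ʳ_)
open import Data.Fin.Properties as Finₚ using (*↔×; +↔⊎)
open import Data.List using (_∷_; [])
open import Data.Nat as ℕ using (ℕ; zero; suc; _+_; _*_; _<_; _%_; parity)
open import Data.Nat.DivMod using (_mod_; m<n⇒m%n≡m; n%n≡0)
open import Data.Nat.Properties using (suc-injective; ≤∧≢⇒<; <-irrefl; n<1+n; *-comm; +-comm; +-suc; m+1+n≢0)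
open import Data.Nat.Tactic.RingSolver using (solve; solve-∀)
open import Data.Parity.Base using (Parity; 0ℙ; 1ℙ; _⁻¹)
open import Data.Parity.Properties using (suc-homo-⁻¹; *-homo-*)
open import Data.Product using (_×_; _,_; proj₁; proj₂; map₁; ∃-syntax)
open import Data.Product.Algebra using (×-cong; ×-comm)
open import Data.Product.Properties using (≡-dec)
open import Data.Sum as Sum using (_⊎_; inj₁; inj₂)
open import Data.Sum.Algebra using (⊎-cong)
open import Data.Unit using (⊤; tt)
open import Function.Base using (_∘_)
open import Function.Bundles using (_↔_; Inverse; Injection; mk↔ₛ′)
open import Function.Properties.Inverse using (↔-trans; ↔-sym; ↔-refl; ↔⇒↣)
open import Relation.Binary.Construct.Union using (_∪_)
open import Relation.Binary.PropositionalEquality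
open import Relation.Nullary using (Dec; yes; no; does; ¬_)
open import Relation.Nullary.Decidable using (map′; _×-dec_; _→-dec_; ¬?; from-yes)

open import Defs

-- Cyclic successor on Fin

toℕ-next : ∀ {n} (i : Fin (suc n)) → toℕ (next i) ≡ suc (toℕ i) % suc n
toℕ-next i = Finₚ.toℕ-fromℕ< _

toℕ-next-< : ∀ {n} (i : Fin (suc n)) → suc (toℕ i) < suc n → toℕ (next i) ≡ suc (toℕ i)
toℕ-next-< i lt = trans (toℕ-next i) (m<n⇒m%n≡m lt)

next-of-toℕ : ∀ {n} {i j : Fin (suc n)} → toℕ j ≡ suc (toℕ i) → next i ≡ j
next-of-toℕ {i = i} {j} eq =
  Finₚ.toℕ-injective (trans (toℕ-next-< i (subst (_< _) eq (Finₚ.toℕ<n j))) (sym eq))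

next-of-last : ∀ {n} {i : Fin (suc n)} → toℕ i ≡ n → next i ≡ zero
next-of-last {n} {i} eq =
  Finₚ.toℕ-injective (trans (toℕ-next i) (trans (cong (λ k → suc k % suc n) eq) (n%n≡0 (suc n))))

isLast : ∀ {n} → Fin (suc n) → Bool
isLast {n} i = does (toℕ i ℕ.≟ n)

data LastView {n} (i : Fin (suc n)) : Bool → Set where
  last    : toℕ i ≡ n → LastView i true
  notLast : toℕ i ≢ n → LastView i false

lastView : ∀ {n} (i : Fin (suc n)) → LastView i (isLast i)
lastView {n} i = view (toℕ i ℕ.≟ n)
  where
  view : (d : Dec (toℕ i ≡ n)) → LastView i (does d)
  view (yes eq) = last eq
  view (no neq) = notLast neq

toℕ-next-notLast : ∀ {n} (i : Fin (suc n)) → toℕ i ≢ n → toℕ (next i) ≡ suc (toℕ i)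
toℕ-next-notLast i neq = toℕ-next-< i (≤∧≢⇒< (Finₚ.toℕ<n i) (λ eq → neq (suc-injective eq)))

next≢ : ∀ {n} → n ≢ 0 → (i : Fin (suc n)) → next i ≢ i
next≢ n≢0 i eq with isLast i | lastView i
... | _ | last isL = n≢0 (trans (sym isL) (cong toℕ (trans (sym eq) (next-of-last isL))))
... | _ | notLast ¬isL = <-irrefl (trans (sym (cong toℕ eq)) (toℕ-next-notLast i ¬isL)) (n<1+n (toℕ i))

prev : ∀ {n} → Fin (suc n) → Fin (suc n)
prev {n} zero = fromℕ n
prev (suc i)  = inject₁ i

toℕ-prev : ∀ {n a} (i : Fin (suc n)) → toℕ i ≡ suc a → toℕ (prev i) ≡ a
toℕ-prev (suc i) eq = trans (Finₚ.toℕ-inject₁ i) (suc-injective eq)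

next-prev : ∀ {n} (i : Fin (suc n)) → next (prev i) ≡ i
next-prev {n} zero = next-of-last (Finₚ.toℕ-fromℕ n)
next-prev (suc i)  = next-of-toℕ (cong suc (sym (Finₚ.toℕ-inject₁ i)))

prev-next : ∀ {n} (i : Fin (suc n)) → prev (next i) ≡ i
prev-next {n} i with isLast i | lastView i
... | _ | last isL =
  trans (cong prev (next-of-last isL)) (Finₚ.toℕ-injective (trans (Finₚ.toℕ-fromℕ n) (sym isL)))
... | _ | notLast ¬isL = Finₚ.toℕ-injective (toℕ-prev (next i) (toℕ-next-notLast i ¬isL))

rotation : ∀ {n} → Fin (suc n) ↔ Fin (suc n)
rotation = mk↔ₛ′ next prev next-prev prev-next

CyclicSuccessor : ℕ → ℕ → ℕ → Set
CyclicSuccessor N a b = b ≡ suc a ⊎ (suc a ≡ N × b ≡ 0)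

next-of-cyclicSuccessor : ∀ {N} {p q : Fin (suc N)} → CyclicSuccessor (suc N) (toℕ p) (toℕ q) → next p ≡ q
next-of-cyclicSuccessor (inj₁ eq) = next-of-toℕ eq
next-of-cyclicSuccessor (inj₂ (eq , q≡0)) =
  trans (next-of-last (suc-injective eq)) (sym (Finₚ.toℕ-injective q≡0))

-- Cycle factorizations on arbitrary vertex and index types

record CycleFactorOn (X : Set) (ℓ : ℕ) : Set where
  field
    k          : ℕ
    cyc        : Fin k → Fin ℓ → X
    injective  : ∀ j i j′ i′ → cyc j i ≡ cyc j′ i′ → (j ≡ j′ × i ≡ i′)
    surjective : ∀ v → ∃[ j ] ∃[ i ] cyc j i ≡ v

HasArcOn : ∀ {X ℓ} → CycleFactorOn X ℓ → X → X → Set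
HasArcOn F u v = ∃[ j ] ∃[ i ] (CycleFactorOn.cyc F j i ≡ u × CycleFactorOn.cyc F j (next i) ≡ v)

record CycleFactorizationOn (X : Set) (ℓ : ℕ) (I : Set) : Set where
  field
    factor   : I → CycleFactorOn X ℓ
    noLoops  : ∀ s u v → HasArcOn (factor s) u v → u ≢ v
    covers   : ∀ u v → u ≢ v → ∃[ s ] HasArcOn (factor s) u v
    disjoint : ∀ u v s s′ → HasArcOn (factor s) u v → HasArcOn (factor s′) u v → s ≡ s′

module _ {X : Set} {n : ℕ} (vertices : X ↔ Fin n) where
  open Inverse vertices

  relabelFactor : ∀ {ℓ} → CycleFactorOn X ℓ → CycleFactor n ℓ
  relabelFactor F = record
    { k          = F.k
    ; cyc        = λ j i → to (F.cyc j i)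
    ; injective  = λ j i j′ i′ eq → F.injective j i j′ i′ (Injection.injective (↔⇒↣ vertices) eq)
    ; surjective = λ v → let (j , i , eq) = F.surjective (from v)
                          in j , i , trans (cong to eq) (strictlyInverseˡ v)
    }
    where
    module F = CycleFactorOn F

  relabelFactor-arc⁻ : ∀ {ℓ} (F : CycleFactorOn X ℓ) {u v} →
                       HasArc (relabelFactor F) u v → HasArcOn F (from u) (from v)
  relabelFactor-arc⁻ F (j , i , eu , ev) =
    j , i , trans (sym (strictlyInverseʳ _)) (cong from eu) , trans (sym (strictlyInverseʳ _)) (cong from ev)

  relabelFactor-arc⁺ : ∀ {ℓ} (F : CycleFactorOn X ℓ) {u v} →
                       HasArcOn F (from u) (from v) → HasArc (relabelFactor F) u v
  relabelFactor-arc⁺ F (j , i , eu , ev) =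
    j , i , trans (cong to eu) (strictlyInverseˡ _) , trans (cong to ev) (strictlyInverseˡ _)

  relabel : ∀ {ℓ I t} → I ↔ Fin t → CycleFactorizationOn X ℓ I → CycleFactorization n ℓ
  relabel {ℓ} {t = t} indices Z = record
    { t        = t
    ; factor   = relabelFactor ∘ factorAt
    ; noLoops  = λ s u v arc eq → noLoops (I.from s) _ _ (relabelFactor-arc⁻ (factorAt s) arc) (cong from eq)
    ; covers   = λ u v u≢v →
        let (s , arc) = covers (from u) (from v) (u≢v ∘ Injection.injective (↔⇒↣ (↔-sym vertices)))
        in I.to s , relabelFactor-arc⁺ (factorAt (I.to s))
                                       (subst (λ s → HasArcOn (factor s) _ _) (sym (I.strictlyInverseʳ s)) arc)
    ; disjoint = λ u v s s′ arc arc′ →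
        trans (sym (I.strictlyInverseˡ s))
              (trans (cong I.to (disjoint _ _ _ _ (relabelFactor-arc⁻ (factorAt s) arc)
                                                  (relabelFactor-arc⁻ (factorAt s′) arc′)))
                     (I.strictlyInverseˡ s′))
    }
    where
    open CycleFactorizationOn Z
    module I = Inverse indices
    factorAt : Fin t → CycleFactorOn X ℓ
    factorAt = factor ∘ I.from

-- Hamiltonian decompositions and blowing up a factorization

record Tour (ℓ : ℕ) (Y : Set) : Set where
  field
    visit            : Fin ℓ → Y
    visit-injective  : ∀ {p q} → visit p ≡ visit q → p ≡ q
    visit-surjective : ∀ y → ∃[ p ] visit p ≡ y
open Tour using (visit)

tourOf : ∀ {ℓ Y} → Y ↔ Fin ℓ → Tour ℓ Y
tourOf r = record
  { visit            = Inverse.from r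
  ; visit-injective  = Injection.injective (↔⇒↣ (↔-sym r))
  ; visit-surjective = λ y → Inverse.to r y , Inverse.strictlyInverseʳ r y
  }

module _ {X : Set} {N : ℕ} (rank : X ↔ Fin N) (step : X → X) where
  open Inverse rank

  enumeration-next : (∀ x → next (to x) ≡ to (step x)) → ∀ p → from (next p) ≡ step (from p)
  enumeration-next rank-step p = begin
    from (next p)               ≡⟨ cong (from ∘ next) (strictlyInverseˡ p) ⟨
    from (next (to (from p)))   ≡⟨ cong from (rank-step (from p)) ⟩
    from (to (step (from p)))   ≡⟨ strictlyInverseʳ (step (from p)) ⟩
    step (from p)               ∎
    where open ≡-Reasoning

data Advance {m L : ℕ} : Fin m × Fin L → Fin m × Fin L → Set where
  advance : ∀ {i x y} → Advance (i , x) (next i , y)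

data Turn {m L : ℕ} : Fin m × Fin L → Fin m × Fin L → Set where
  turn : ∀ {i x y} → x ≢ y → Turn (i , x) (i , y)

record HamiltonianDecomposition {Y : Set} (S : Y → Y → Set) (ℓ K : ℕ) : Set where
  field
    tour   : Fin K → Tour ℓ Y
    steps  : ∀ e p → S (visit (tour e) p) (visit (tour e) (next p))
    unique : ∀ {e e′ p p′} → visit (tour e) p ≡ visit (tour e′) p′ →
             visit (tour e) (next p) ≡ visit (tour e′) (next p′) → e ≡ e′
    covers : ∀ {y y′} → S y y′ → ∃[ e ] ∃[ p ] (visit (tour e) p ≡ y × visit (tour e) (next p) ≡ y′)

module Lifting {n m L ℓ : ℕ} (F : CycleFactor n m) where

  place : Fin (k F) → Fin m × Fin L → Fin n × Fin L
  place j (i , x) = cyc F j i , x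

  place-injective : ∀ {j j′ y y′} → place j y ≡ place j′ y′ → y ≡ y′
  place-injective {j} {j′} {i , x} {i′ , x′} eq =
    cong₂ _,_ (proj₂ (injective F j i j′ i′ (cong proj₁ eq))) (cong proj₂ eq)

  lift : Tour ℓ (Fin m × Fin L) → CycleFactorOn (Fin n × Fin L) ℓ
  lift τ = record
    { k          = k F
    ; cyc        = λ j p → place j (visit τ p)
    ; injective  = λ j p j′ p′ eq →
        proj₁ (injective F j _ j′ _ (cong proj₁ eq)) , Tour.visit-injective τ (place-injective eq)
    ; surjective = λ (v , x) →
        let (j , i , eq) = surjective F v
            (p , eq′) = Tour.visit-surjective τ (i , x)
        in j , p , trans (cong (place j) eq′) (cong (_, x) eq)
    }

  module _ (τ : Tour ℓ (Fin m × Fin L)) where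

    arc-of-step : ∀ {p j i i′ u v a b} → visit τ p ≡ (i , a) → visit τ (next p) ≡ (i′ , b) →
                  cyc F j i ≡ u → cyc F j i′ ≡ v → HasArcOn (lift τ) (u , a) (v , b)
    arc-of-step {p} {j} eτ eτ′ eu ev =
      j , p , trans (cong (place j) eτ) (cong (_, _) eu) , trans (cong (place j) eτ′) (cong (_, _) ev)

    advance-arc : (∀ p → Advance (visit τ p) (visit τ (next p))) →
                  ∀ {u a v b} → HasArcOn (lift τ) (u , a) (v , b) → HasArc F u v
    advance-arc steps (j , p , eu , ev) = project (steps p) eu ev
      where
      project : ∀ {y y′ u a v b} → Advance y y′ → place j y ≡ (u , a) → place j y′ ≡ (v , b) → HasArc F u v
      project (advance {i}) refl refl = j , i , refl , refl

    step-arc : (∀ p → (Advance ∪ Turn) (visit τ p) (visit τ (next p))) →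
               ∀ {u a v b} → HasArcOn (lift τ) (u , a) (v , b) → HasArc F u v ⊎ (u ≡ v × a ≢ b)
    step-arc steps (j , p , eu , ev) = project (steps p) eu ev
      where
      project : ∀ {y y′ u a v b} → (Advance ∪ Turn) y y′ → place j y ≡ (u , a) → place j y′ ≡ (v , b) →
                HasArc F u v ⊎ (u ≡ v × a ≢ b)
      project (inj₁ (advance {i})) refl refl = inj₁ (j , i , refl , refl)
      project (inj₂ (turn x≢y)) refl refl = inj₂ (refl , x≢y)

  same-step : ∀ τ τ′ {x y} → HasArcOn (lift τ) x y → HasArcOn (lift τ′) x y →
              ∃[ p ] ∃[ p′ ] (visit τ p ≡ visit τ′ p′ × visit τ (next p) ≡ visit τ′ (next p′))
  same-step τ τ′ (j , p , eu , ev) (j′ , p′ , eu′ , ev′) =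
    p , p′ , place-injective (trans eu (sym eu′)) , place-injective (trans ev (sym ev′))

module BlowUp {n m L L′ ℓ : ℕ} (H : CycleFactorization n m) (σ₀ : Fin (CycleFactorization.t H))
  (N : HamiltonianDecomposition (Advance {m} {L}) ℓ L)
  (S : HamiltonianDecomposition (Advance {m} {L} ∪ Turn) ℓ (L + L′)) where

  open CycleFactorization H using (t; factor; noLoops)
  module H = CycleFactorization H
  module N = HamiltonianDecomposition N
  module S = HamiltonianDecomposition S
  open Lifting

  data Role : Set where
    normal  : Fin t → Fin L → Role
    special : Fin (L + L′) → Role

  liftOf : Role → CycleFactorOn (Fin n × Fin L) ℓ
  liftOf (normal σ s) = lift (factor σ) (N.tour s)
  liftOf (special e)  = lift (factor σ₀) (S.tour e)

  Used : Role → Set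
  Used (normal σ _) = σ ≢ σ₀
  Used (special _)  = ⊤

  normal-arc : ∀ σ s {u a v b} → HasArcOn (liftOf (normal σ s)) (u , a) (v , b) → HasArc (factor σ) u v
  normal-arc σ s = advance-arc (factor σ) (N.tour s) (N.steps s)

  special-arc : ∀ e {u a v b} → HasArcOn (liftOf (special e)) (u , a) (v , b) →
                HasArc (factor σ₀) u v ⊎ (u ≡ v × a ≢ b)
  special-arc e = step-arc (factor σ₀) (S.tour e) (S.steps e)

  lift-noLoops : ∀ d x y → HasArcOn (liftOf d) x y → x ≢ y
  lift-noLoops (normal σ s) _ _ arc refl = noLoops σ _ _ (normal-arc σ s arc) refl
  lift-noLoops (special e) _ _ arc refl with special-arc e arc
  ... | inj₁ arcᴴ = noLoops σ₀ _ _ arcᴴ refl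
  ... | inj₂ (_ , a≢a) = a≢a refl

  lift-covers : ∀ x y → x ≢ y → ∃[ d ] (Used d × HasArcOn (liftOf d) x y)
  lift-covers (u , a) (v , b) x≢y with u Fin.≟ v
  ... | yes refl =
    let (j , i , eu) = surjective (factor σ₀) u
        (e , p , e₁ , e₂) = S.covers (inj₂ (turn {i = i} (λ a≡b → x≢y (cong (u ,_) a≡b))))
    in special e , tt , arc-of-step (factor σ₀) (S.tour e) e₁ e₂ eu eu
  ... | no u≢v with H.covers u v u≢v
  ...   | σ , j , i , eu , ev with σ Fin.≟ σ₀
  ...     | yes refl =
    let (e , p , e₁ , e₂) = S.covers (inj₁ (advance {i = i} {a} {b}))
    in special e , tt , arc-of-step (factor σ₀) (S.tour e) e₁ e₂ eu ev
  ...     | no σ≢σ₀ =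
    let (s , p , e₁ , e₂) = N.covers (advance {i = i} {a} {b})
    in normal σ s , σ≢σ₀ , arc-of-step (factor σ) (N.tour s) e₁ e₂ eu ev

  lift-disjoint : ∀ d d′ → Used d → Used d′ → ∀ {x y} →
                  HasArcOn (liftOf d) x y → HasArcOn (liftOf d′) x y → d ≡ d′
  lift-disjoint (normal σ s) (normal σ′ s′) _ _ {_ , _} {_ , _} arc arc′
    with H.disjoint _ _ σ σ′ (normal-arc σ s arc) (normal-arc σ′ s′ arc′)
  ... | refl =
    let (p , p′ , e₁ , e₂) = same-step (factor σ) (N.tour s) (N.tour s′) arc arc′
    in cong (normal σ) (N.unique e₁ e₂)
  lift-disjoint (normal σ s) (special e) σ≢σ₀ _ {_ , _} {_ , _} arc arc′ with special-arc e arc′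
  ... | inj₁ arcᴴ = ⊥-elim (σ≢σ₀ (H.disjoint _ _ σ σ₀ (normal-arc σ s arc) arcᴴ))
  ... | inj₂ (refl , _) = ⊥-elim (noLoops σ _ _ (normal-arc σ s arc) refl)
  lift-disjoint (special e) (normal σ s) _ σ≢σ₀ {_ , _} {_ , _} arc arc′ with special-arc e arc
  ... | inj₁ arcᴴ = ⊥-elim (σ≢σ₀ (H.disjoint _ _ σ σ₀ (normal-arc σ s arc′) arcᴴ))
  ... | inj₂ (refl , _) = ⊥-elim (noLoops σ _ _ (normal-arc σ s arc′) refl)
  lift-disjoint (special e) (special e′) _ _ arc arc′ =
    let (p , p′ , e₁ , e₂) = same-step (factor σ₀) (S.tour e) (S.tour e′) arc arc′
    in cong special (S.unique e₁ e₂)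

  Index : Set
  Index = (Fin t × Fin L) ⊎ Fin L′

  -- The three normal slots of σ₀ go to the first three special tours.
  roleAt : ∀ σ → Dec (σ ≡ σ₀) → Fin L → Role
  roleAt σ (yes _) s = special (s ↑ˡ L′)
  roleAt σ (no _)  s = normal σ s

  role : Index → Role
  role (inj₁ (σ , s)) = roleAt σ (σ Fin.≟ σ₀) s
  role (inj₂ e)       = special (L ↑ʳ e)

  role-used : ∀ ι → Used (role ι)
  role-used (inj₁ (σ , s)) = used (σ Fin.≟ σ₀)
    where
    used : ∀ d → Used (roleAt σ d s)
    used (yes _)  = tt
    used (no σ≢σ₀) = σ≢σ₀
  role-used (inj₂ e) = tt

  index : Role → Index
  index (normal σ s) = inj₁ (σ , s)
  index (special e)  = Sum.[ (λ s → inj₁ (σ₀ , s)) , inj₂ ] (Fin.splitAt L e)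

  index-role : ∀ ι → index (role ι) ≡ ι
  index-role (inj₁ (σ , s)) with σ Fin.≟ σ₀
  ... | yes refl = cong Sum.[ (λ s → inj₁ (σ₀ , s)) , inj₂ ] (Finₚ.splitAt-↑ˡ L s L′)
  ... | no _     = refl
  index-role (inj₂ e) = cong Sum.[ (λ s → inj₁ (σ₀ , s)) , inj₂ ] (Finₚ.splitAt-↑ʳ L L′ e)

  role-index : ∀ d → Used d → role (index d) ≡ d
  role-index (normal σ s) σ≢σ₀ with σ Fin.≟ σ₀
  ... | yes σ≡σ₀ = ⊥-elim (σ≢σ₀ σ≡σ₀)
  ... | no _     = refl
  role-index (special e) _ with Fin.splitAt L e in split
  ... | inj₂ e′ = cong special (Finₚ.splitAt⁻¹-↑ʳ split)
  ... | inj₁ s with σ₀ Fin.≟ σ₀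
  ...   | yes _    = cong special (Finₚ.splitAt⁻¹-↑ˡ split)
  ...   | no σ₀≢σ₀ = ⊥-elim (σ₀≢σ₀ refl)

  blowUp : CycleFactorizationOn (Fin n × Fin L) ℓ Index
  blowUp = record
    { factor   = λ ι → liftOf (role ι)
    ; noLoops  = λ ι → lift-noLoops (role ι)
    ; covers   = λ x y x≢y →
        let (d , used , arc) = lift-covers x y x≢y
        in index d , subst (λ d → HasArcOn (liftOf d) x y) (sym (role-index d used)) arc
    ; disjoint = λ x y ι ι′ arc arc′ →
        trans (sym (index-role ι))
              (trans (cong index (lift-disjoint (role ι) (role ι′) (role-used ι) (role-used ι′) arc arc′))
                     (index-role ι′))
    }

  Index↔ : Index ↔ Fin (t * L + L′)
  Index↔ = ↔-trans (⊎-cong (↔-sym *↔×) ↔-refl) (↔-sym +↔⊎)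

-- Four enumerations of Fin m × Fin 3

pattern 0F = zero
pattern 1F = suc zero
pattern 2F = suc (suc zero)
pattern 3F = suc (suc (suc zero))
pattern 4F = suc (suc (suc (suc zero)))

cast↔ : ∀ {a b} → a ≡ b → Fin a ↔ Fin b
cast↔ eq = mk↔ₛ′ (Fin.cast eq) (Fin.cast (sym eq))
  (Finₚ.cast-involutive eq (sym eq)) (Finₚ.cast-involutive (sym eq) eq)

snakeRank : ∀ {m L} → (Fin m × Fin L) ↔ Fin (L * m)
snakeRank {m} {L} = ↔-trans (↔-sym *↔×) (cast↔ (*-comm m L))

toℕ-snakeRank : ∀ {m L} (i : Fin m) (t : Fin L) → toℕ (Inverse.to snakeRank (i , t)) ≡ L * toℕ i + toℕ t
toℕ-snakeRank {m} {L} i t = trans (Finₚ.toℕ-cast (*-comm m L) (Fin.combine i t)) (Finₚ.toℕ-combine i t)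

splitLevel : ∀ {m} → (Fin m × Fin 3) ↔ (Fin m ⊎ (Fin m × Fin 2))
splitLevel {m} = mk↔ₛ′ to from to-from from-to
  where
  to : Fin m × Fin 3 → Fin m ⊎ (Fin m × Fin 2)
  to (i , 0F) = inj₂ (i , 0F)
  to (i , 1F) = inj₂ (i , 1F)
  to (i , 2F) = inj₁ i
  from : Fin m ⊎ (Fin m × Fin 2) → Fin m × Fin 3
  from (inj₁ i) = i , 2F
  from (inj₂ (i , t)) = i , inject₁ t
  to-from : ∀ y → to (from y) ≡ y
  to-from (inj₁ i) = refl
  to-from (inj₂ (i , 0F)) = refl
  to-from (inj₂ (i , 1F)) = refl
  from-to : ∀ x → from (to x) ≡ x
  from-to (i , 0F) = refl
  from-to (i , 1F) = refl
  from-to (i , 2F) = refl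

-- The orders in which a tour visits the cells (i , x). winding runs through all positions
-- at level 0, then at 1, then at 2; snake visits the three levels of one position after the
-- other; double first runs through all positions at level 2 and then visits levels 0 and 1
-- of each position; double′ is double rotated by one position. levelStep returns whether
-- the position advances and the new level, given whether the current position is the last
-- one (for double′: the one before last).
data Kind : Set where
  winding snake double double′ : Kind

move : ∀ {n} → Bool → Fin (suc n) → Fin (suc n)
move true  i = next i
move false i = i

doubleStep : Bool → Fin 3 → Bool × Fin 3
doubleStep f 0F = false , 1F
doubleStep f 1F = true , (if f then 2F else 0F)
doubleStep f 2F = true , (if f then 0F else 2F)

levelStep : Kind → Bool → Fin 3 → Bool × Fin 3
levelStep winding f q = true , (if f then next q else q)
levelStep snake _ 0F = false , 1F
levelStep snake _ 1F = false , 2F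
levelStep snake _ 2F = true , 0F
levelStep double f ρ = doubleStep f ρ
levelStep double′ f ρ = doubleStep f ρ

module Skeletons (n : ℕ) where

  Cell : Set
  Cell = Fin (suc n) × Fin 3

  flag : Kind → Fin (suc n) → Bool
  flag double′ i = isLast (next i)
  flag _       i = isLast i

  moveBy : Bool × Fin 3 → Fin (suc n) → Cell
  moveBy (b , ρ′) i = move b i , ρ′

  skeletonStep : Kind → Cell → Cell
  skeletonStep k (i , ρ) = moveBy (levelStep k (flag k i) ρ) i

  doubleRank : Cell ↔ Fin (3 * suc n)
  doubleRank = ↔-trans splitLevel (↔-trans (⊎-cong ↔-refl snakeRank) (↔-sym (+↔⊎ {suc n})))

  rank : Kind → Cell ↔ Fin (3 * suc n)
  rank winding = ↔-trans (×-comm _ _) (↔-sym *↔×)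
  rank snake   = snakeRank
  rank double  = doubleRank
  rank double′ = ↔-trans (×-cong rotation ↔-refl) doubleRank

  windingIndex : Cell → ℕ
  windingIndex (i , q) = suc n * toℕ q + toℕ i

  windingIndex-step : ∀ i q → CyclicSuccessor (3 * suc n) (windingIndex (i , q))
                                          (windingIndex (next i , (if isLast i then next q else q)))
  windingIndex-step i q with isLast i | lastView i
  ... | _ | notLast ¬isL = inj₁ (trans (cong (suc n * toℕ q +_) (toℕ-next-notLast i ¬isL)) (+-suc _ _))
  ... | _ | last isL rewrite cong toℕ (next-of-last isL) | isL = wrap q
    where
    wrap : ∀ q → CyclicSuccessor (3 * suc n) (suc n * toℕ q + n) (suc n * toℕ (next q) + 0)
    wrap 0F = inj₁ (solve (n ∷ []))
    wrap 1F = inj₁ (solve (n ∷ []))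
    wrap 2F = inj₂ (solve (n ∷ []) , solve (n ∷ []))

  snakeIndex : Cell → ℕ
  snakeIndex (i , t) = 3 * toℕ i + toℕ t

  snakeIndex-step : ∀ x → CyclicSuccessor (3 * suc n) (snakeIndex x) (snakeIndex (skeletonStep snake x))
  snakeIndex-step (i , 0F) = inj₁ (+-suc _ 0)
  snakeIndex-step (i , 1F) = inj₁ (+-suc _ 1)
  snakeIndex-step (i , 2F) with isLast i | lastView i
  ... | _ | notLast ¬isL rewrite toℕ-next-notLast i ¬isL = inj₁ (arith (toℕ i))
    where
    arith : ∀ a → 3 * suc a + 0 ≡ suc (3 * a + 2)
    arith = solve-∀
  ... | _ | last isL rewrite cong toℕ (next-of-last isL) | isL = inj₂ (solve (n ∷ []) , refl)

  doubleIndex : Cell → ℕ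
  doubleIndex (i , 0F) = suc n + (2 * toℕ i + 0)
  doubleIndex (i , 1F) = suc n + (2 * toℕ i + 1)
  doubleIndex (i , 2F) = toℕ i

  doubleIndex-step : ∀ x → CyclicSuccessor (3 * suc n) (doubleIndex x) (doubleIndex (skeletonStep double x))
  doubleIndex-step (i , 0F) = inj₁ (arith n (toℕ i))
    where
    arith : ∀ n a → suc n + (2 * a + 1) ≡ suc (suc n + (2 * a + 0))
    arith = solve-∀
  doubleIndex-step (i , 1F) with isLast i | lastView i
  ... | _ | notLast ¬isL rewrite toℕ-next-notLast i ¬isL = inj₁ (arith n (toℕ i))
    where
    arith : ∀ n a → suc n + (2 * suc a + 0) ≡ suc (suc n + (2 * a + 1))
    arith = solve-∀
  ... | _ | last isL rewrite cong toℕ (next-of-last isL) | isL = inj₂ (solve (n ∷ []) , refl)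
  doubleIndex-step (i , 2F) with isLast i | lastView i
  ... | _ | notLast ¬isL rewrite toℕ-next-notLast i ¬isL = inj₁ refl
  ... | _ | last isL rewrite cong toℕ (next-of-last isL) | isL = inj₁ (solve (n ∷ []))

  rank-step-from-index : ∀ k (index : Cell → ℕ) → (∀ x → toℕ (Inverse.to (rank k) x) ≡ index x) →
                 ∀ x → CyclicSuccessor (3 * suc n) (index x) (index (skeletonStep k x)) →
                 next (Inverse.to (rank k) x) ≡ Inverse.to (rank k) (skeletonStep k x)
  rank-step-from-index k index toℕ-rank x succ =
    next-of-cyclicSuccessor (subst₂ (CyclicSuccessor _) (sym (toℕ-rank x)) (sym (toℕ-rank _)) succ)

  toℕ-doubleRank : ∀ x → toℕ (Inverse.to doubleRank x) ≡ doubleIndex x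
  toℕ-doubleRank (i , 0F) = trans (Finₚ.toℕ-↑ʳ (suc n) _) (cong (suc n +_) (toℕ-snakeRank i 0F))
  toℕ-doubleRank (i , 1F) = trans (Finₚ.toℕ-↑ʳ (suc n) _) (cong (suc n +_) (toℕ-snakeRank i 1F))
  toℕ-doubleRank (i , 2F) = Finₚ.toℕ-↑ˡ i _

  moveBy-next : ∀ s i → moveBy s (next i) ≡ map₁ next (moveBy s i)
  moveBy-next (true , _)  i = refl
  moveBy-next (false , _) i = refl

  rank-step : ∀ k x → next (Inverse.to (rank k) x) ≡ Inverse.to (rank k) (skeletonStep k x)
  rank-step winding (i , q) =
    rank-step-from-index winding windingIndex (λ (i , q) → Finₚ.toℕ-combine q i) (i , q) (windingIndex-step i q)
  rank-step snake x  = rank-step-from-index snake snakeIndex (λ (i , t) → toℕ-snakeRank i t) x (snakeIndex-step x)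
  rank-step double x = rank-step-from-index double doubleIndex toℕ-doubleRank x (doubleIndex-step x)
  rank-step double′ (i , ρ) =
    trans (rank-step double (next i , ρ))
          (cong (Inverse.to doubleRank) (moveBy-next (doubleStep (isLast (next i)) ρ) i))

  skeleton : Kind → Tour (3 * suc n) Cell
  skeleton k = tourOf (rank k)

  skeleton-next : ∀ k p → visit (skeleton k) (next p) ≡ skeletonStep k (visit (skeleton k) p)
  skeleton-next k = enumeration-next (rank k) (skeletonStep k) (rank-step k)

-- Local arc tables

data Class : Set where
  A B C : Class

data Transition : Set where
  AB BA BC CA : Transition

source : Transition → Class
source AB = A
source BA = B
source BC = B
source CA = C

target : Transition → Class
target AB = B
target BA = A
target BC = C
target CA = A

leavesLast : Transition → Bool
leavesLast CA = true
leavesLast _  = false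

entersLast : Transition → Bool
entersLast BC = true
entersLast _  = false

localFlag : Kind → Transition → Bool
localFlag double′ t = entersLast t
localFlag _       t = leavesLast t

-- (x , b , y) is a step from level x to level y that advances the position iff b.
LocalArc : Set
LocalArc = Fin 3 × Bool × Fin 3

_≟ᴬ_ : (a a′ : LocalArc) → Dec (a ≡ a′)
_≟ᴬ_ = ≡-dec Fin._≟_ (≡-dec Bool._≟_ Fin._≟_)

data LocalStep : LocalArc → Set where
  advance : ∀ {x y} → LocalStep (x , true , y)
  turn    : ∀ {x y} → x ≢ y → LocalStep (x , false , y)

IsAdvance : LocalArc → Set
IsAdvance (_ , b , _) = b ≡ true

localStep? : ∀ a → Dec (LocalStep a)
localStep? (x , true , y)  = yes advance
localStep? (x , false , y) = map′ turn (λ { (turn x≢y) → x≢y }) (¬? (x Fin.≟ y))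

isAdvance? : ∀ a → Dec (IsAdvance a)
isAdvance? (_ , b , _) = b Bool.≟ true

∀-localArc? : {P : LocalArc → Set} → (∀ a → Dec (P a)) → Dec (∀ a → P a)
∀-localArc? P? = map′ (λ f (x , b , y) → f x b y) (λ f x b y → f (x , b , y))
  (Finₚ.all? λ x → ∀-bool? λ b → Finₚ.all? λ y → P? (x , b , y))
  where
  ∀-bool? : {P : Bool → Set} → (∀ b → Dec (P b)) → Dec (∀ b → P b)
  ∀-bool? P? = map′ (λ (f , t) → λ { false → f ; true → t }) (λ g → g false , g true) (P? false ×-dec P? true)

∀-class? : {P : Class → Set} → (∀ c → Dec (P c)) → Dec (∀ c → P c)
∀-class? P? = map′ (λ (a , b , c) → λ { A → a ; B → b ; C → c }) (λ f → f A , f B , f C)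
                   (P? A ×-dec P? B ×-dec P? C)

∀-transition? : {P : Transition → Set} → (∀ t → Dec (P t)) → Dec (∀ t → P t)
∀-transition? P? = map′ (λ (a , b , c , d) → λ { AB → a ; BA → b ; BC → c ; CA → d })
                        (λ f → f AB , f BA , f BC , f CA)
                        (P? AB ×-dec P? BA ×-dec P? BC ×-dec P? CA)

module Design {K : ℕ} (kind : Fin K → Kind) (levels : Fin K → Class → Fin 3 → Fin 3) where

  arcWith : Fin K → Transition → Fin 3 → Bool × Fin 3 → LocalArc
  arcWith e t ρ (b , ρ′) = levels e (source t) ρ , b , levels e (if b then target t else source t) ρ′

  localArc : Fin K → Transition → Fin 3 → LocalArc
  localArc e t ρ = arcWith e t ρ (levelStep (kind e) (localFlag (kind e) t) ρ)

  Relabels : Set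
  Relabels = ∀ e c → (∀ ρ ρ′ → levels e c ρ ≡ levels e c ρ′ → ρ ≡ ρ′) × (∀ x → ∃[ ρ ] levels e c ρ ≡ x)

  relabels? : Dec Relabels
  relabels? = Finₚ.all? λ e → ∀-class? λ c →
    (Finₚ.all? λ ρ → Finₚ.all? λ ρ′ → (levels e c ρ Fin.≟ levels e c ρ′) →-dec (ρ Fin.≟ ρ′)) ×-dec
    (Finₚ.all? λ x → Finₚ.any? λ ρ → levels e c ρ Fin.≟ x)

  Unique : Set
  Unique = ∀ t e e′ ρ ρ′ → localArc e t ρ ≡ localArc e′ t ρ′ → e ≡ e′

  unique? : Dec Unique
  unique? = ∀-transition? λ t → Finₚ.all? λ e → Finₚ.all? λ e′ → Finₚ.all? λ ρ → Finₚ.all? λ ρ′ →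
    (localArc e t ρ ≟ᴬ localArc e′ t ρ′) →-dec (e Fin.≟ e′)

  Sound : (LocalArc → Set) → Set
  Sound Allowed = ∀ t e ρ → Allowed (localArc e t ρ)

  sound? : {Allowed : LocalArc → Set} → (∀ a → Dec (Allowed a)) → Dec (Sound Allowed)
  sound? allowed? = ∀-transition? λ t → Finₚ.all? λ e → Finₚ.all? λ ρ → allowed? (localArc e t ρ)

  Covers : (LocalArc → Set) → Set
  Covers Allowed = ∀ t a → Allowed a → ∃[ e ] ∃[ ρ ] localArc e t ρ ≡ a

  covers? : {Allowed : LocalArc → Set} → (∀ a → Dec (Allowed a)) → Dec (Covers Allowed)
  covers? allowed? = ∀-transition? λ t → ∀-localArc? λ a →
    allowed? a →-dec (Finₚ.any? λ e → Finₚ.any? λ ρ → localArc e t ρ ≟ᴬ a)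

_⊕_ : Fin 3 → Fin 3 → Fin 3
x ⊕ y = (toℕ x + toℕ y) mod 3

-- Design s adds s·c to the levels at class c = 0, 1, 2; classes of consecutive positions
-- differ, so the three designs together realise each advancing step exactly once.
normalLevels : Fin 3 → Class → Fin 3 → Fin 3
normalLevels s A x = x
normalLevels s B x = s ⊕ x
normalLevels s C x = (s ⊕ s) ⊕ x

normalKind : Fin 3 → Kind
normalKind _ = winding

module Normal = Design normalKind normalLevels

specialKind : Fin 5 → Kind
specialKind 0F = winding
specialKind 1F = snake
specialKind 2F = snake
specialKind 3F = double
specialKind 4F = double′

images : Fin 3 → Fin 3 → Fin 3 → Fin 3 → Fin 3
images a b c 0F = a
images a b c 1F = b
images a b c 2F = c

specialLevels : Fin 5 → Class → Fin 3 → Fin 3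
specialLevels 0F A = images 0F 1F 2F
specialLevels 1F A = images 0F 1F 2F
specialLevels 2F A = images 1F 0F 2F
specialLevels 3F A = images 2F 0F 1F
specialLevels 4F A = images 2F 1F 0F
specialLevels 0F B = images 0F 2F 1F
specialLevels 1F B = images 0F 1F 2F
specialLevels 2F B = images 2F 1F 0F
specialLevels 3F B = images 2F 0F 1F
specialLevels 4F B = images 0F 2F 1F
specialLevels 0F C = images 1F 2F 0F
specialLevels 1F C = images 0F 1F 2F
specialLevels 2F C = images 2F 1F 0F
specialLevels 3F C = images 0F 2F 1F
specialLevels 4F C = images 2F 0F 1F

module Special = Design specialKind specialLevels

normal-relabels : Normal.Relabels
normal-relabels = from-yes Normal.relabels?

normal-unique : Normal.Unique
normal-unique = from-yes Normal.unique?

normal-sound : Normal.Sound IsAdvance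
normal-sound = from-yes (Normal.sound? isAdvance?)

normal-covers : Normal.Covers IsAdvance
normal-covers = from-yes (Normal.covers? isAdvance?)

special-relabels : Special.Relabels
special-relabels = from-yes Special.relabels?

special-unique : Special.Unique
special-unique = from-yes Special.unique?

special-sound : Special.Sound LocalStep
special-sound = from-yes (Special.sound? localStep?)

special-covers : Special.Covers LocalStep
special-covers = from-yes (Special.covers? localStep?)

-- Odd cycles

parityClass : Parity → Class
parityClass 0ℙ = A
parityClass 1ℙ = B

parityTransition : Parity → Transition
parityTransition 0ℙ = AB
parityTransition 1ℙ = BA

parity-suc : ∀ k → parity (suc k) ≡ parity k ⁻¹
parity-suc k = sym (suc-homo-⁻¹ (suc k))

module OddCycle (n : ℕ) (n-even : parity n ≡ 0ℙ) (n≢0 : n ≢ 0) where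
  open Skeletons n

  -- As n = m − 1 is even, the classes around the cycle read A B A B … A B C.
  class : Fin (suc n) → Class
  class i = if isLast i then C else parityClass (parity (toℕ i))

  transition : Fin (suc n) → Transition
  transition i = if isLast i then CA else (if isLast (next i) then BC else parityTransition (parity (toℕ i)))

  last-next-notLast : ∀ {i : Fin (suc n)} → toℕ i ≡ n → toℕ (next i) ≢ n
  last-next-notLast isL eq = n≢0 (trans (sym eq) (cong toℕ (next-of-last isL)))

  source-transition : ∀ i → source (transition i) ≡ class i
  source-transition i with isLast i | lastView i
  ... | _ | last _ = refl
  ... | _ | notLast ¬isL with isLast (next i) | lastView (next i)
  ...   | _ | last isL′ = cong parityClass (sym (begin
          parity (toℕ i)              ≡⟨ suc-homo-⁻¹ (toℕ i) ⟨
          parity (suc (toℕ i)) ⁻¹     ≡⟨ cong (λ k → parity k ⁻¹) (trans (sym (toℕ-next-notLast i ¬isL)) isL′) ⟩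
          parity n ⁻¹                 ≡⟨ cong _⁻¹ n-even ⟩
          1ℙ                          ∎))
    where open ≡-Reasoning
  ...   | _ | notLast _ = source-parity (parity (toℕ i))
    where
    source-parity : ∀ p → source (parityTransition p) ≡ parityClass p
    source-parity 0ℙ = refl
    source-parity 1ℙ = refl

  target-transition : ∀ i → target (transition i) ≡ class (next i)
  target-transition i with isLast i | lastView i
  ... | _ | last isL with isLast (next i) | lastView (next i)
  ...   | _ | last isL′ = ⊥-elim (last-next-notLast isL isL′)
  ...   | _ | notLast _ rewrite next-of-last isL = refl
  target-transition i | _ | notLast ¬isL with isLast (next i) | lastView (next i)
  ...   | _ | last _ = refl
  ...   | _ | notLast _ rewrite toℕ-next-notLast i ¬isL | parity-suc (toℕ i) =
    target-parity (parity (toℕ i))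
    where
    target-parity : ∀ p → target (parityTransition p) ≡ parityClass (p ⁻¹)
    target-parity 0ℙ = refl
    target-parity 1ℙ = refl

  leavesLast-transition : ∀ i → leavesLast (transition i) ≡ isLast i
  leavesLast-transition i with isLast i
  ... | true  = refl
  ... | false with isLast (next i)
  ...   | true  = refl
  ...   | false = leavesLast-parity (parity (toℕ i))
    where
    leavesLast-parity : ∀ p → leavesLast (parityTransition p) ≡ false
    leavesLast-parity 0ℙ = refl
    leavesLast-parity 1ℙ = refl

  entersLast-transition : ∀ i → entersLast (transition i) ≡ isLast (next i)
  entersLast-transition i with isLast i | lastView i
  ... | _ | last isL with isLast (next i) | lastView (next i)
  ...   | _ | last isL′ = ⊥-elim (last-next-notLast isL isL′)
  ...   | _ | notLast _ = refl
  entersLast-transition i | _ | notLast _ with isLast (next i)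
  ...   | true  = refl
  ...   | false = entersLast-parity (parity (toℕ i))
    where
    entersLast-parity : ∀ p → entersLast (parityTransition p) ≡ false
    entersLast-parity 0ℙ = refl
    entersLast-parity 1ℙ = refl

  localFlag-transition : ∀ k i → localFlag k (transition i) ≡ flag k i
  localFlag-transition winding = leavesLast-transition
  localFlag-transition snake   = leavesLast-transition
  localFlag-transition double  = leavesLast-transition
  localFlag-transition double′ = entersLast-transition

  class-move : ∀ b i → class (move b i) ≡ (if b then target (transition i) else source (transition i))
  class-move true  i = sym (target-transition i)
  class-move false i = sym (source-transition i)

  realise : Fin (suc n) → LocalArc → Cell × Cell
  realise i (x , b , y) = (i , x) , (move b i , y)

  realise-injective : ∀ {i i′} a a′ → realise i a ≡ realise i′ a′ → i ≡ i′ × a ≡ a′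
  realise-injective (x , b , y) (x′ , b′ , y′) eq with cong (proj₁ ∘ proj₁) eq
  ... | refl = refl , cong₂ _,_ (cong (proj₂ ∘ proj₁) eq)
                                (cong₂ _,_ (move-injective b b′ (cong (proj₁ ∘ proj₂) eq))
                                           (cong (proj₂ ∘ proj₂) eq))
    where
    move-injective : ∀ {i} b b′ → move b i ≡ move b′ i → b ≡ b′
    move-injective true  true  _  = refl
    move-injective false false _  = refl
    move-injective true  false eq = ⊥-elim (next≢ n≢0 _ eq)
    move-injective false true  eq = ⊥-elim (next≢ n≢0 _ (sym eq))

  realise-advance : ∀ {u v} i a → (u , v) ≡ realise i a → IsAdvance a → Advance u v
  realise-advance i (x , true , y) refl refl = advance

  realise-step : ∀ {u v} i a → (u , v) ≡ realise i a → LocalStep a → (Advance ∪ Turn) u v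
  realise-step i _ refl advance     = inj₁ advance
  realise-step i _ refl (turn x≢y) = inj₂ (turn x≢y)

  module Realisation {K} (kind : Fin K → Kind) (levels : Fin K → Class → Fin 3 → Fin 3)
    (relabels : Design.Relabels kind levels) (unique : Design.Unique kind levels) where
    open Design kind levels

    relevel : Fin K → Cell → Cell
    relevel e (i , ρ) = i , levels e (class i) ρ

    tour : Fin K → Tour (3 * suc n) Cell
    tour e = record
      { visit            = relevel e ∘ visit (skeleton (kind e))
      ; visit-injective  = λ eq → Tour.visit-injective (skeleton (kind e)) (relevel-injective (cong proj₁ eq) eq)
      ; visit-surjective = λ (i , x) →
          let (ρ , eρ) = proj₂ (relabels e (class i)) x
              (p , ep) = Tour.visit-surjective (skeleton (kind e)) (i , ρ)
          in p , trans (cong (relevel e) ep) (cong (i ,_) eρ)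
      }
      where
      relevel-injective : ∀ {i ρ i′ ρ′} → i ≡ i′ → relevel e (i , ρ) ≡ relevel e (i′ , ρ′) → (i , ρ) ≡ (i′ , ρ′)
      relevel-injective {i} refl eq = cong (i ,_) (proj₁ (relabels e (class i)) _ _ (cong proj₂ eq))

    tourArc : Fin K → Fin (3 * suc n) → Cell × Cell
    tourArc e p = visit (tour e) p , visit (tour e) (next p)

    arc-realises : ∀ e p {i ρ} → visit (skeleton (kind e)) p ≡ (i , ρ) →
                   tourArc e p ≡ realise i (localArc e (transition i) ρ)
    arc-realises e p {i} {ρ} eq
      rewrite skeleton-next (kind e) p | eq | localFlag-transition (kind e) i
      with levelStep (kind e) (flag (kind e) i) ρ
    ... | b , ρ′ = cong₂ _,_ (cong (λ c → i , levels e c ρ) (sym (source-transition i)))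
                             (cong (λ c → move b i , levels e c ρ′) (class-move b i))

    arc-unique : ∀ {e e′ p p′} → visit (tour e) p ≡ visit (tour e′) p′ →
                 visit (tour e) (next p) ≡ visit (tour e′) (next p′) → e ≡ e′
    arc-unique {e} {e′} {p} {p′} eq₁ eq₂ =
      unique (transition i) e e′ ρ ρ′ (trans a≡a′ (cong (λ j → localArc e′ (transition j) ρ′) (sym i≡i′)))
      where
      i  = proj₁ (visit (skeleton (kind e)) p)
      ρ  = proj₂ (visit (skeleton (kind e)) p)
      ρ′ = proj₂ (visit (skeleton (kind e′)) p′)
      realised = realise-injective _ _
        (trans (sym (arc-realises e p refl)) (trans (cong₂ _,_ eq₁ eq₂) (arc-realises e′ p′ refl)))
      i≡i′ = proj₁ realised
      a≡a′ = proj₂ realised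

    arc-covers : ∀ {Allowed} → Covers Allowed → ∀ i a → Allowed a →
                 ∃[ e ] ∃[ p ] (visit (tour e) p ≡ proj₁ (realise i a) ×
                                visit (tour e) (next p) ≡ proj₂ (realise i a))
    arc-covers covers i a allowed =
      let (e , ρ , eq) = covers (transition i) a allowed
          (p , ep) = Tour.visit-surjective (skeleton (kind e)) (i , ρ)
          arc = trans (arc-realises e p ep) (cong (realise i) eq)
      in e , p , cong proj₁ arc , cong proj₂ arc

    arc-allowed : ∀ {Allowed} → Sound Allowed → ∀ e p → ∃[ i ] ∃[ a ] (Allowed a × tourArc e p ≡ realise i a)
    arc-allowed sound e p = _ , _ , sound _ e _ , arc-realises e p refl

  normalDecomposition : HamiltonianDecomposition (Advance {suc n} {3}) (3 * suc n) 3
  normalDecomposition = record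
    { tour   = tour
    ; steps  = λ e p → let (i , a , adv , eq) = arc-allowed {IsAdvance} normal-sound e p
                       in realise-advance i a eq adv
    ; unique = arc-unique
    ; covers = λ { (advance {i} {x} {y}) → arc-covers {IsAdvance} normal-covers i (x , true , y) refl }
    }
    where open Realisation normalKind normalLevels normal-relabels normal-unique

  specialDecomposition : HamiltonianDecomposition (Advance {suc n} {3} ∪ Turn) (3 * suc n) (3 + 2)
  specialDecomposition = record
    { tour   = tour
    ; steps  = λ e p → let (i , a , step , eq) = arc-allowed {LocalStep} special-sound e p
                       in realise-step i a eq step
    ; unique = arc-unique
    ; covers = λ
        { (inj₁ (advance {i} {x} {y}))  → arc-covers {LocalStep} special-covers i (x , true , y) advance
        ; (inj₂ (turn {i} {x} {y} x≢y)) → arc-covers {LocalStep} special-covers i (x , false , y) (turn x≢y)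
        }
    }
    where open Realisation specialKind specialLevels special-relabels special-unique

some-factor : ∀ {N ℓ} → N ≢ 0 → (H : CycleFactorization (suc N) ℓ) → Fin (CycleFactorization.t H)
some-factor N≢0 H = proj₁ (CycleFactorization.covers H zero (next zero) (λ eq → next≢ N≢0 zero (sym eq)))

no-C₁-factorization : ∀ {N} → N ≢ 0 → ¬ CycleFactorization (suc N) 1
no-C₁-factorization N≢0 H with CycleFactorization.covers H zero (next zero) (λ eq → next≢ N≢0 zero (sym eq))
... | _ , _ , zero , eu , ev = next≢ N≢0 zero (trans (sym ev) eu)

tripling : ∀ n → parity n ≡ 0ℙ → n ≢ 0 →
           HasCFactorization (2 * suc n) (suc n) → HasCFactorization (2 * (3 * suc n)) (3 * suc n)
tripling n n-even n≢0 H =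
  subst (λ N → CycleFactorization N (3 * suc n)) (arith n) (relabel (↔-sym *↔×) Index↔ blowUp)
  where
  open OddCycle n n-even n≢0
  open BlowUp H (some-factor (m+1+n≢0 n) H) normalDecomposition specialDecomposition
  arith : ∀ n → 2 * suc n * 3 ≡ 2 * (3 * suc n)
  arith = solve-∀

lemma24 : (m : ℕ) → ∃[ r ] m ≡ 2 * r + 1 →
    HasCFactorization (2 * m) m → HasCFactorization (2 * (3 * m)) (3 * m)
lemma24 .(2 * r + 1) (r , refl) rewrite +-comm (2 * r) 1 = odd r
  where
  odd : ∀ r → HasCFactorization (2 * suc (2 * r)) (suc (2 * r)) →
        HasCFactorization (2 * (3 * suc (2 * r))) (3 * suc (2 * r))
  odd zero    H = ⊥-elim (no-C₁-factorization (λ ()) H)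
  odd (suc r) = tripling (2 * suc r) (*-homo-* 2 (suc r)) (λ ())
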